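{- Let $\mathcal{X}\subseteq\{0,1\}^n$ be nonempty and let $\mathcal{U}=\{c_1,\dots,c_K\}\subset\mathbb{R}^n_{\ge0}$ with $K=2^k$. Let $0\le\ell\le k$, let $S_1,\dots,S_{2^\ell}$ be a partition of $[K]$ into sets each of cardinality $2^{k-\ell}$, set $\overline{c}_j=\frac{1}{2^{k-\ell}}\sum_{s\in S_j}c_s$ and $\overline{\mathcal{U}}(\ell)=\{\overline{c}_1,\dots,\overline{c}_{2^\ell}\}$. Let $\alpha\ge1$. If $x'\in\mathcal{X}$ satisfies $\max_{j\in[2^\ell]}\overline{c}_j^tx'\le\alpha\min_{x\in\mathcal{X}}\max_{j\in[2^\ell]}\overline{c}_j^tx$, then $\max_{i\in[K]}c_i^tx'\le \frac{\alpha K}{2^\ell}\min_{x\in\mathcal{X}}\max_{i\in[K]}c_i^tx$.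
   Context: This says an $\alpha$-approximation for the min-max problem with scenario set $\overline{\mathcal{U}}(\ell)$ is an $(\alpha K/2^\ell)$-approximation for the min-max problem $\min_{x\in\mathcal{X}}\max_{c\in\mathcal{U}}c^tx$.
   Formalization: The scenarios $c_1,\dots,c_K$ have nonnegative rational entries instead of lying in $\mathbb{R}^n_{\ge0}$, and the factor α is rational. -}

module Defs where

open import Data.Nat as ℕ using (ℕ; _^_)
open import Data.Nat.Properties using (m^n≢0)
open import Data.Bool using (Bool; true; false; if_then_else_)
open import Data.Fin using (Fin)
open import Data.Vec using (lookup)
open import Data.Vec.Functional using (Vector; foldr)
open import Data.Fin.Subset using (Subset; inside; outside)
open import Data.List.NonEmpty using (List⁺; foldr₁; map)
open import Data.Integer using (ℤ; +_)
open import Data.Rational using (ℚ; 0ℚ; 1ℚ; _+_; _*_; _⊔_; _⊓_; _/_)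

BinVec : ℕ → Set
BinVec n = Fin n → Bool

CostVec : ℕ → Set
CostVec n = Fin n → ℚ

Σ : ∀ {m} → (Fin m → ℚ) → ℚ
Σ f = foldr _+_ 0ℚ f

_·_ : ∀ {n} → CostVec n → BinVec n → ℚ
c · x = Σ (λ i → if x i then c i else 0ℚ)

-- maximum over a finite index set [m]; the value for m = 0 is 0
-- (only used for m = 2^k ≥ 1 and nonnegative values, so this base case is harmless)
maxFin : ∀ {m} → (Fin m → ℚ) → ℚ
maxFin f = foldr _⊔_ 0ℚ f

minList⁺ : ∀ {A : Set} → List⁺ A → (A → ℚ) → ℚ
minList⁺ X f = foldr₁ _⊓_ (map f X)

_/2^_ : ℤ → ℕ → ℚ
a /2^ e = a / (2 ^ e)
  where instance _ = m^n≢0 2 e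

avgScenario : ∀ {n} (k ℓ : ℕ) → (Fin (2 ^ k) → CostVec n) →
              (Fin (2 ^ ℓ) → Subset (2 ^ k)) → Fin (2 ^ ℓ) → CostVec n
avgScenario k ℓ c S j i =
  ((+ 1) /2^ (k ℕ.∸ ℓ)) * Σ (λ s → if lookup (S j) s then c s i else 0ℚ)

{-# OPTIONS --safe #-}

-- Write r = 2^k / 2^ℓ = 2^(k-ℓ) for the common size of the blocks S_j.  For every
-- x, each averaged scenario c̄_j is the mean of r original scenarios, so
-- max_j c̄_j x ≤ max_i c_i x.  Conversely, since the costs are nonnegative and
-- every i lies in some S_j, c_i x ≤ Σ_{s ∈ S_j} c_s x = r c̄_j x, so
-- max_i c_i x ≤ r max_j c̄_j x.  Use the second inequality at x′ and the first
-- inside the minimum over X.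

module Submission where

open import Defs
open import Data.Nat as ℕ using (ℕ; _^_; suc)
import Data.Nat.Properties as ℕ
open import Data.Fin using (Fin; zero; suc)
open import Data.Fin.Subset using (Subset; _∈_; ∣_∣)
open import Data.List.NonEmpty using (List⁺; toList; _∷_)
open import Data.List using ([]; _∷_)
open import Data.List.Membership.Propositional renaming (_∈_ to _∈L_)
open import Data.Product using (∃; _,_)
open import Data.Bool using (true; false; if_then_else_)
open import Data.Vec as Vec using (lookup)
open import Data.Vec.Properties using ([]=⇒lookup)
open import Data.Integer as ℤ using (+_)
import Data.Integer.Properties as ℤ
open import Data.Rational using (ℚ; mkℚ; 0ℚ; 1ℚ; _≤_; _+_; _*_; _/_; ↥_; ↧ₙ_; toℚᵘ; NonNegative; nonNegative)
import Data.Rational.Properties as ℚ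
import Data.Rational.Unnormalised.Base as ℚᵘ
import Data.Rational.Unnormalised.Properties as ℚᵘ
open import Algebra.Bundles using (Ring)
open import Algebra.Properties.Semiring.Sum (Ring.semiring ℚ.+-*-ring)
  using (sum-cong-≗; ∑-comm; *-distribˡ-sum; sum-replicate-zero)
open import Function using (_∘_)
open import Relation.Binary.PropositionalEquality using (_≡_; refl; sym; trans; cong; cong₂; subst; module ≡-Reasoning)

toℚᵘ-/ : ∀ i n .{{_ : ℕ.NonZero n}} → toℚᵘ (i / n) ℚᵘ.≃ (i ℚᵘ./ n)
toℚᵘ-/ i (suc n) = ℚ./-injective-≃ _ _ (trans (↥/↧-toℚᵘ (i / suc n)) (ℚ.↥p/↧p≡p (i / suc n)))
  where
  ↥/↧-toℚᵘ : ∀ p → ℚᵘ.↥ toℚᵘ p / ℚᵘ.↧ₙ toℚᵘ p ≡ ↥ p / ↧ₙ p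
  ↥/↧-toℚᵘ (mkℚ _ _ _) = refl

/-*-/≡1 : ∀ a b c d .{{_ : ℕ.NonZero b}} .{{_ : ℕ.NonZero d}} →
          a ℕ.* c ≡ b ℕ.* d → (+ a / b) * (+ c / d) ≡ 1ℚ
/-*-/≡1 a b@(suc _) c d@(suc _) ac≡bd = ℚ.toℚᵘ-injective (begin
  toℚᵘ ((+ a / b) * (+ c / d))            ≈⟨ ℚ.toℚᵘ-homo-* (+ a / b) (+ c / d) ⟩
  toℚᵘ (+ a / b) ℚᵘ.* toℚᵘ (+ c / d)      ≈⟨ ℚᵘ.*-cong (toℚᵘ-/ (+ a) b) (toℚᵘ-/ (+ c) d) ⟩
  (+ a ℚᵘ./ b) ℚᵘ.* (+ c ℚᵘ./ d)          ≈⟨ ℚᵘ.*≡* cross ⟩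
  ℚᵘ.1ℚᵘ                                 ∎)
  where
  open ℚᵘ.≃-Reasoning
  cross : (+ a ℤ.* + c) ℤ.* ℤ.1ℤ ≡ ℤ.1ℤ ℤ.* + (b ℕ.* d)
  cross = trans (ℤ.*-identityʳ _) (trans (sym (ℤ.pos-* a c)) (trans (cong +_ ac≡bd) (sym (ℤ.*-identityˡ _))))

/1-homo-+ : ∀ m n → + (m ℕ.+ n) / 1 ≡ (+ m / 1) + (+ n / 1)
/1-homo-+ m n = ℚ.toℚᵘ-injective (begin
  toℚᵘ (+ (m ℕ.+ n) / 1)                  ≈⟨ toℚᵘ-/ (+ (m ℕ.+ n)) 1 ⟩
  + (m ℕ.+ n) ℚᵘ./ 1                      ≈⟨ ℚᵘ.*≡* cross ⟩
  (+ m ℚᵘ./ 1) ℚᵘ.+ (+ n ℚᵘ./ 1)          ≈⟨ ℚᵘ.+-cong (toℚᵘ-/ (+ m) 1) (toℚᵘ-/ (+ n) 1) ⟨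
  toℚᵘ (+ m / 1) ℚᵘ.+ toℚᵘ (+ n / 1)      ≈⟨ ℚ.toℚᵘ-homo-+ (+ m / 1) (+ n / 1) ⟨
  toℚᵘ ((+ m / 1) + (+ n / 1))            ∎)
  where
  open ℚᵘ.≃-Reasoning
  cross : + (m ℕ.+ n) ℤ.* ℤ.1ℤ ≡ (+ m ℤ.* ℤ.1ℤ ℤ.+ + n ℤ.* ℤ.1ℤ) ℤ.* ℤ.1ℤ
  cross = cong (ℤ._* ℤ.1ℤ) (trans (ℤ.pos-+ m n) (sym (cong₂ ℤ._+_ (ℤ.*-identityʳ (+ m)) (ℤ.*-identityʳ (+ n)))))

/2^-nonNeg : ∀ a e → NonNegative ((+ a) /2^ e)
/2^-nonNeg a e = ℚ.normalize-nonNeg a (2 ^ e) {{ℕ.m^n≢0 2 e}}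

2^k/2^ℓ*1/2^[k∸ℓ]≡1 : ∀ {k ℓ} → ℓ ℕ.≤ k → ((+ (2 ^ k)) /2^ ℓ) * ((+ 1) /2^ (k ℕ.∸ ℓ)) ≡ 1ℚ
2^k/2^ℓ*1/2^[k∸ℓ]≡1 {k} {ℓ} ℓ≤k = /-*-/≡1 (2 ^ k) (2 ^ ℓ) 1 (2 ^ (k ℕ.∸ ℓ))
  {{ℕ.m^n≢0 2 ℓ}} {{ℕ.m^n≢0 2 (k ℕ.∸ ℓ)}} (begin
    2 ^ k ℕ.* 1               ≡⟨ ℕ.*-identityʳ (2 ^ k) ⟩
    2 ^ k                     ≡⟨ cong (2 ^_) (ℕ.m+[n∸m]≡n ℓ≤k) ⟨
    2 ^ (ℓ ℕ.+ (k ℕ.∸ ℓ))     ≡⟨ ℕ.^-distribˡ-+-* 2 ℓ (k ℕ.∸ ℓ) ⟩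
    2 ^ ℓ ℕ.* 2 ^ (k ℕ.∸ ℓ)   ∎)
  where open ≡-Reasoning

1/2^e*2^e≡1 : ∀ e → ((+ 1) /2^ e) * ((+ (2 ^ e)) / 1) ≡ 1ℚ
1/2^e*2^e≡1 e = /-*-/≡1 1 (2 ^ e) (2 ^ e) 1 {{ℕ.m^n≢0 2 e}}
  (trans (ℕ.*-identityˡ (2 ^ e)) (sym (ℕ.*-identityʳ (2 ^ e))))

p*q≡1⇒p*[q*r]≡r : ∀ p q → p * q ≡ 1ℚ → ∀ r → p * (q * r) ≡ r
p*q≡1⇒p*[q*r]≡r p q pq≡1 r = begin
  p * (q * r)   ≡⟨ ℚ.*-assoc p q r ⟨
  (p * q) * r   ≡⟨ cong (_* r) pq≡1 ⟩
  1ℚ * r        ≡⟨ ℚ.*-identityˡ r ⟩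
  r             ∎
  where open ≡-Reasoning

p≤p+q : ∀ p {q} → 0ℚ ≤ q → p ≤ p + q
p≤p+q p {q} 0≤q = subst (_≤ p + q) (ℚ.+-identityʳ p) (ℚ.+-monoʳ-≤ p 0≤q)

p≤q+p : ∀ p {q} → 0ℚ ≤ q → p ≤ q + p
p≤q+p p {q} 0≤q = subst (_≤ q + p) (ℚ.+-identityˡ p) (ℚ.+-monoˡ-≤ p 0≤q)

if-then-0-comm : ∀ a b (v : ℚ) →
  (if a then (if b then v else 0ℚ) else 0ℚ) ≡ (if b then (if a then v else 0ℚ) else 0ℚ)
if-then-0-comm true  b     v = refl
if-then-0-comm false true  v = refl
if-then-0-comm false false v = refl

if-then-0-nonNeg : ∀ b {v} → 0ℚ ≤ v → 0ℚ ≤ (if b then v else 0ℚ)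
if-then-0-nonNeg true  0≤v = 0≤v
if-then-0-nonNeg false _   = ℚ.≤-refl

if-then-0-*ˡ : ∀ b a (v : ℚ) → (if b then a * v else 0ℚ) ≡ a * (if b then v else 0ℚ)
if-then-0-*ˡ true  a v = refl
if-then-0-*ˡ false a v = sym (ℚ.*-zeroʳ a)

if-then-0-Σ : ∀ {m} b (f : Fin m → ℚ) → (if b then Σ f else 0ℚ) ≡ Σ (λ i → if b then f i else 0ℚ)
if-then-0-Σ         true  f = refl
if-then-0-Σ {m = m} false f = sym (sum-replicate-zero m)

Σ-nonNeg : ∀ {m} {f : Fin m → ℚ} → (∀ i → 0ℚ ≤ f i) → 0ℚ ≤ Σ f
Σ-nonNeg {ℕ.zero} _   = ℚ.≤-refl
Σ-nonNeg {suc m}  f≥0 = ℚ.+-mono-≤ (f≥0 zero) (Σ-nonNeg (f≥0 ∘ suc))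

≤-Σ : ∀ {m} {f : Fin m → ℚ} → (∀ i → 0ℚ ≤ f i) → ∀ i → f i ≤ Σ f
≤-Σ {f = f} f≥0 zero    = p≤p+q (f zero) (Σ-nonNeg (f≥0 ∘ suc))
≤-Σ         f≥0 (suc i) = ℚ.≤-trans (≤-Σ (f≥0 ∘ suc) i) (p≤q+p _ (f≥0 zero))

≤-maxFin : ∀ {m} (f : Fin m → ℚ) i → f i ≤ maxFin f
≤-maxFin f zero    = ℚ.p≤p⊔q _ _
≤-maxFin f (suc i) = ℚ.≤-trans (≤-maxFin (f ∘ suc) i) (ℚ.p≤q⊔p (f zero) _)

maxFin-nonNeg : ∀ {m} (f : Fin m → ℚ) → 0ℚ ≤ maxFin f
maxFin-nonNeg {ℕ.zero} f = ℚ.≤-refl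
maxFin-nonNeg {suc m}  f = ℚ.≤-trans (maxFin-nonNeg (f ∘ suc)) (ℚ.p≤q⊔p (f zero) _)

maxFin-lub : ∀ {m} (f : Fin m → ℚ) {B} → 0ℚ ≤ B → (∀ i → f i ≤ B) → maxFin f ≤ B
maxFin-lub {ℕ.zero} f 0≤B _   = 0≤B
maxFin-lub {suc m}  f 0≤B f≤B = ℚ.⊔-lub (f≤B zero) (maxFin-lub (f ∘ suc) 0≤B (f≤B ∘ suc))

minList⁺-mono-≤ : ∀ {A : Set} (X : List⁺ A) {f g : A → ℚ} →
                  (∀ x → f x ≤ g x) → minList⁺ X f ≤ minList⁺ X g
minList⁺-mono-≤ (x ∷ xs) {f} {g} f≤g = go x xs
  where
  go : ∀ x xs → minList⁺ (x ∷ xs) f ≤ minList⁺ (x ∷ xs) g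
  go x []       = f≤g x
  go x (y ∷ ys) = ℚ.⊓-mono-≤ (f≤g x) (go y ys)

ΣOver : ∀ {m} → Subset m → (Fin m → ℚ) → ℚ
ΣOver p f = Σ (λ s → if lookup p s then f s else 0ℚ)

ΣOver-≤-∣∣* : ∀ {m} (p : Subset m) {f : Fin m → ℚ} {B} → (∀ s → f s ≤ B) →
              ΣOver p f ≤ ((+ ∣ p ∣) / 1) * B
ΣOver-≤-∣∣* Vec.[]          {B = B} _   = ℚ.≤-reflexive (sym (ℚ.*-zeroˡ B))
ΣOver-≤-∣∣* (false Vec.∷ p) {B = B} f≤B =
  subst (_≤ ((+ ∣ p ∣) / 1) * B) (sym (ℚ.+-identityˡ _)) (ΣOver-≤-∣∣* p (f≤B ∘ suc))
ΣOver-≤-∣∣* (true Vec.∷ p)  {f} {B} f≤B = begin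
  f zero + ΣOver p (f ∘ suc)                ≤⟨ ℚ.+-mono-≤ (f≤B zero) (ΣOver-≤-∣∣* p (f≤B ∘ suc)) ⟩
  B + ((+ ∣ p ∣) / 1) * B                   ≡⟨ cong (_+ ((+ ∣ p ∣) / 1) * B) (ℚ.*-identityˡ B) ⟨
  1ℚ * B + ((+ ∣ p ∣) / 1) * B              ≡⟨ ℚ.*-distribʳ-+ B 1ℚ ((+ ∣ p ∣) / 1) ⟨
  (1ℚ + (+ ∣ p ∣) / 1) * B                  ≡⟨ cong (_* B) (/1-homo-+ 1 ∣ p ∣) ⟨
  ((+ suc ∣ p ∣) / 1) * B                   ∎
  where open ℚ.≤-Reasoning

∈⇒≤-ΣOver : ∀ {m} {p : Subset m} {f : Fin m → ℚ} → (∀ s → 0ℚ ≤ f s) → ∀ {s} → s ∈ p → f s ≤ ΣOver p f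
∈⇒≤-ΣOver {p = p} {f} f≥0 {s} s∈p =
  subst (λ b → (if b then f s else 0ℚ) ≤ ΣOver p f) ([]=⇒lookup s∈p)
    (≤-Σ (λ t → if-then-0-nonNeg (lookup p t) (f≥0 t)) s)

·-nonNeg : ∀ {n} {c : CostVec n} → (∀ r → 0ℚ ≤ c r) → ∀ x → 0ℚ ≤ c · x
·-nonNeg c≥0 x = Σ-nonNeg (λ r → if-then-0-nonNeg (x r) (c≥0 r))

·-*ˡ : ∀ {n} a (c : CostVec n) x → (λ r → a * c r) · x ≡ a * (c · x)
·-*ˡ a c x = trans (sum-cong-≗ (λ r → if-then-0-*ˡ (x r) a (c r)))
                   (sym (*-distribˡ-sum a (λ r → if x r then c r else 0ℚ)))

·-ΣOver : ∀ {m n} (p : Subset m) (c : Fin m → CostVec n) x →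
          (λ r → ΣOver p (λ s → c s r)) · x ≡ ΣOver p (λ s → c s · x)
·-ΣOver p c x = begin
  Σ (λ r → if x r then Σ (λ s → if lookup p s then c s r else 0ℚ) else 0ℚ)
    ≡⟨ sum-cong-≗ (λ r → if-then-0-Σ (x r) (λ s → if lookup p s then c s r else 0ℚ)) ⟩
  Σ (λ r → Σ (λ s → if x r then (if lookup p s then c s r else 0ℚ) else 0ℚ))
    ≡⟨ ∑-comm (λ r s → if x r then (if lookup p s then c s r else 0ℚ) else 0ℚ) ⟩
  Σ (λ s → Σ (λ r → if x r then (if lookup p s then c s r else 0ℚ) else 0ℚ))
    ≡⟨ sum-cong-≗ (λ s → sum-cong-≗ (λ r → if-then-0-comm (x r) (lookup p s) (c s r))) ⟩
  Σ (λ s → Σ (λ r → if lookup p s then (if x r then c s r else 0ℚ) else 0ℚ))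
    ≡⟨ sum-cong-≗ (λ s → if-then-0-Σ (lookup p s) (λ r → if x r then c s r else 0ℚ)) ⟨
  ΣOver p (λ s → c s · x) ∎
  where open ≡-Reasoning

avgScenario-· : ∀ {n} k ℓ (c : Fin (2 ^ k) → CostVec n) S j x →
  avgScenario k ℓ c S j · x ≡ ((+ 1) /2^ (k ℕ.∸ ℓ)) * ΣOver (S j) (λ s → c s · x)
avgScenario-· k ℓ c S j x =
  trans (·-*ˡ ((+ 1) /2^ (k ℕ.∸ ℓ)) _ x) (cong (((+ 1) /2^ (k ℕ.∸ ℓ)) *_) (·-ΣOver (S j) c x))

worstCase : ∀ {m n} → (Fin m → CostVec n) → BinVec n → ℚ
worstCase c x = maxFin (λ i → c i · x)

worstCase-avgScenario-≤ : ∀ {n} k ℓ (c : Fin (2 ^ k) → CostVec n) S →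
  (∀ j → ∣ S j ∣ ≡ 2 ^ (k ℕ.∸ ℓ)) → ∀ x → worstCase (avgScenario k ℓ c S) x ≤ worstCase c x
worstCase-avgScenario-≤ k ℓ c S ∣S∣≡2^[k∸ℓ] x = maxFin-lub _ (maxFin-nonNeg (λ i → c i · x)) avg≤worst
  where
  instance _ = /2^-nonNeg 1 (k ℕ.∸ ℓ)
  avg≤worst : ∀ j → avgScenario k ℓ c S j · x ≤ worstCase c x
  avg≤worst j = begin
    avgScenario k ℓ c S j · x                          ≡⟨ avgScenario-· k ℓ c S j x ⟩
    d * ΣOver (S j) (λ s → c s · x)                    ≤⟨ ℚ.*-monoˡ-≤-nonNeg d (ΣOver-≤-∣∣* (S j) (≤-maxFin (λ i → c i · x))) ⟩
    d * (((+ ∣ S j ∣) / 1) * worstCase c x)             ≡⟨ cong (λ m → d * (((+ m) / 1) * worstCase c x)) (∣S∣≡2^[k∸ℓ] j) ⟩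
    d * (((+ (2 ^ (k ℕ.∸ ℓ))) / 1) * worstCase c x)     ≡⟨ p*q≡1⇒p*[q*r]≡r d _ (1/2^e*2^e≡1 (k ℕ.∸ ℓ)) _ ⟩
    worstCase c x                                      ∎
    where
    open ℚ.≤-Reasoning
    d = (+ 1) /2^ (k ℕ.∸ ℓ)

worstCase-≤-avgScenario : ∀ {n k ℓ} → ℓ ℕ.≤ k → (c : Fin (2 ^ k) → CostVec n) → (∀ i r → 0ℚ ≤ c i r) →
  (S : Fin (2 ^ ℓ) → Subset (2 ^ k)) → (∀ s → ∃ λ j → s ∈ S j) →
  ∀ x → worstCase c x ≤ ((+ (2 ^ k)) /2^ ℓ) * worstCase (avgScenario k ℓ c S) x
worstCase-≤-avgScenario {k = k} {ℓ} ℓ≤k c c≥0 S cover x = maxFin-lub _ 0≤r*worst c≤r*worst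
  where
  open ℚ.≤-Reasoning
  d = (+ 1) /2^ (k ℕ.∸ ℓ)
  r = (+ (2 ^ k)) /2^ ℓ
  instance _ = /2^-nonNeg (2 ^ k) ℓ
  worst̄ = worstCase (avgScenario k ℓ c S) x

  0≤r*worst : 0ℚ ≤ r * worst̄
  0≤r*worst = begin
    0ℚ          ≡⟨ ℚ.*-zeroʳ r ⟨
    r * 0ℚ      ≤⟨ ℚ.*-monoˡ-≤-nonNeg r (maxFin-nonNeg (λ j → avgScenario k ℓ c S j · x)) ⟩
    r * worst̄   ∎

  c≤r*worst : ∀ i → c i · x ≤ r * worst̄
  c≤r*worst i with cover i
  ... | j , i∈Sj = begin
    c i · x                             ≤⟨ ∈⇒≤-ΣOver (λ s → ·-nonNeg (c≥0 s) x) i∈Sj ⟩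
    ΣOver (S j) (λ s → c s · x)         ≡⟨ p*q≡1⇒p*[q*r]≡r r d (2^k/2^ℓ*1/2^[k∸ℓ]≡1 ℓ≤k) _ ⟨
    r * (d * ΣOver (S j) (λ s → c s · x)) ≡⟨ cong (r *_) (avgScenario-· k ℓ c S j x) ⟨
    r * (avgScenario k ℓ c S j · x)     ≤⟨ ℚ.*-monoˡ-≤-nonNeg r (≤-maxFin (λ j → avgScenario k ℓ c S j · x) j) ⟩
    r * worst̄                           ∎

lemma2 : (n k ℓ : ℕ) → ℓ ℕ.≤ k →
    (X : List⁺ (BinVec n)) →
    (c : Fin (2 ^ k) → CostVec n) → (∀ i r → 0ℚ ≤ c i r) →
    (S : Fin (2 ^ ℓ) → Subset (2 ^ k)) →
    (∀ s → ∃ λ j → s ∈ S j) →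
    (∀ j j′ s → s ∈ S j → s ∈ S j′ → j ≡ j′) →
    (∀ j → ∣ S j ∣ ≡ 2 ^ (k ℕ.∸ ℓ)) →
    (α : ℚ) → 1ℚ ≤ α →
    (x′ : BinVec n) → x′ ∈L toList X →
    maxFin (λ j → avgScenario k ℓ c S j · x′)
      ≤ α * minList⁺ X (λ x → maxFin (λ j → avgScenario k ℓ c S j · x)) →
    maxFin (λ i → c i · x′)
      ≤ (α * ((+ (2 ^ k)) /2^ ℓ)) * minList⁺ X (λ x → maxFin (λ i → c i · x))
lemma2 _ k ℓ ℓ≤k X c c≥0 S cover _ ∣S∣≡2^[k∸ℓ] α 1≤α x′ _ x′-approx = begin
  worstCase c x′                        ≤⟨ worstCase-≤-avgScenario ℓ≤k c c≥0 S cover x′ ⟩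
  r * worstCase c̄ x′                    ≤⟨ ℚ.*-monoˡ-≤-nonNeg r x′-approx ⟩
  r * (α * minList⁺ X (worstCase c̄))    ≤⟨ ℚ.*-monoˡ-≤-nonNeg r (ℚ.*-monoˡ-≤-nonNeg α c̄≤c) ⟩
  r * (α * minList⁺ X (worstCase c))    ≡⟨ ℚ.*-assoc r α _ ⟨
  (r * α) * minList⁺ X (worstCase c)    ≡⟨ cong (_* minList⁺ X (worstCase c)) (ℚ.*-comm r α) ⟩
  (α * r) * minList⁺ X (worstCase c)    ∎
  where
  open ℚ.≤-Reasoning
  r = (+ (2 ^ k)) /2^ ℓ
  c̄ = avgScenario k ℓ c S
  instance
    _ = /2^-nonNeg (2 ^ k) ℓ
    _ = nonNegative (ℚ.≤-trans (ℚ.nonNegative⁻¹ 1ℚ) 1≤α)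
  c̄≤c : minList⁺ X (worstCase c̄) ≤ minList⁺ X (worstCase c)
  c̄≤c = minList⁺-mono-≤ X (worstCase-avgScenario-≤ k ℓ c S ∣S∣≡2^[k∸ℓ])
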